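{- Let $G$ be a finite simple graph, let $X = X_1 \cap \dots \cap X_k$ ($k \ge 1$) where each $X_i$ is a maximum independent set of $G$, and let $A \subseteq V(G)$ be an independent set with $X \subseteq A$. Then \[ |A| - \mu(G[N_G[A]]) \le |X| - \mu(G[N_G[X]]). \]
   Context: $\mu(H)$ denotes the matching number (maximum size of a matching) of a graph $H$, with $\mu(H)=0$ if $H$ has no edges. For $S \subseteq V(G)$, $N_G[S] = S \cup \bigcup_{v \in S} N_G(v)$ and $G[S]$ is the subgraph induced by $S$. -}

module Defs where

open import Data.Nat using (ℕ; suc; _≤_)
open import Data.Fin using (Fin)
open import Data.Fin.Subset using (Subset; _∈_; _∉_; _⊆_; ∣_∣; ⋂)
open import Data.List using (List; length; concatMap; tabulate; _∷_; [])
open import Data.List.Relation.Unary.All using (All)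
open import Data.List.Relation.Unary.Unique.Propositional using (Unique)
open import Data.Product using (_×_; _,_; ∃)
open import Data.Sum using (_⊎_)
open import Relation.Nullary using (¬_; Dec; does)
open import Relation.Nullary.Decidable using (_×-dec_)
open import Data.Bool using (_∨_; if_then_else_)
open import Data.Fin.Subset using (inside; outside)
open import Data.Fin.Subset.Properties using (_∈?_)
open import Data.Fin.Properties using (any?)
import Data.Vec as V
open import Relation.Binary.PropositionalEquality using (_≡_)

record Graph (n : ℕ) : Set₁ where
  field
    Adj     : Fin n → Fin n → Set
    adj?    : ∀ u v → Dec (Adj u v)
    sym     : ∀ {u v} → Adj u v → Adj v u
    irrefl  : ∀ {u} → ¬ Adj u u

open Graph public

module _ {n : ℕ} (G : Graph n) where

  Independent : Subset n → Set
  Independent S = ∀ u v → u ∈ S → v ∈ S → ¬ Adj G u v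

  MaximumIndependent : Subset n → Set
  MaximumIndependent S =
    Independent S × (∀ T → Independent T → ∣ T ∣ ≤ ∣ S ∣)

  N[_] : Subset n → Subset n
  N[ S ] = V.tabulate (λ w → if does (w ∈? S) ∨ does (any? (λ v → v ∈? S ×-dec adj? G v w))
                              then inside else outside)

  endpoints : List (Fin n × Fin n) → List (Fin n)
  endpoints = concatMap (λ { (u , v) → u ∷ v ∷ [] })

  IsMatchingIn : Subset n → List (Fin n × Fin n) → Set
  IsMatchingIn S M =
    All (λ { (u , v) → Adj G u v × u ∈ S × v ∈ S }) M × Unique (endpoints M)

  MatchingNumber : Subset n → ℕ → Set
  MatchingNumber S m =
    (∃ λ M → IsMatchingIn S M × length M ≡ m)
    × (∀ M → IsMatchingIn S M → length M ≤ m)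

⋂Fam : ∀ {n k} → (Fin (suc k) → Subset n) → Subset n
⋂Fam Xs = ⋂ (tabulate Xs)

-- Hall's theorem matches A ─ I into a maximum independent set I along edges of G:
-- a set S ⊆ A ─ I with fewer than |S| neighbours in I is impossible, since
-- S ∪ (I ─ Γ S) would be a larger independent set.  As A and I are independent,
-- these |A ─ I| edges avoid N[A ∩ I], so every matching of G[N[A ∩ I]] grows into a
-- matching of G[N[A]] with |A ─ I| more edges:
--   |A| − μ(G[N[A]]) ≤ |A ∩ I| − μ(G[N[A ∩ I]]).
-- Chaining this along A ⊇ A ∩ X₁ ⊇ A ∩ X₁ ∩ X₂ ⊇ … and using A ∩ X = X gives the claim.

module Submission where

open import Defs hiding (sym)
open import Data.Bool using (Bool; true; false)
open import Data.Empty using (⊥-elim)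
open import Data.Fin using (Fin; zero; suc)
open import Data.Fin.Properties using (any?; _≟_; suc-injective)
open import Data.Fin.Subset
  using (Subset; _∈_; _∉_; _⊆_; _∩_; _∪_; _─_; ⁅_⁆; ∣_∣; ⋂; Nonempty; Empty)
open import Data.Fin.Subset.Properties
  using ( _∈?_; _⊆?_; anySubset?; nonempty?; Empty-unique; ∣⊥∣≡0; ∣p∣≤∣x∷p∣; ∣⁅x⁆∣≡1; x∈⁅x⁆; x∈⁅y⁆⇒x≡y
        ; p⊆q⇒∣p∣≤∣q∣; x∈p∩q⁺; x∈p∩q⁻; x∈p∪q⁺; x∈p∪q⁻; p∩q⊆p; p∩q⊆q; p─q⊆p; x∈p∧x∉q⇒x∈p─q
        ; p∩q≢∅⇒∣p─q∣<∣p∣; ∩-identityʳ; ∩-assoc; ⊆-antisym )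
open import Data.List using (List; []; _∷_; _++_; length; map)
open import Data.List.Membership.Propositional using () renaming (_∈_ to _∈ₗ_)
open import Data.List.Relation.Unary.All using (All; []; _∷_)
open import Data.Nat using (ℕ; suc)
open import Data.Product using (_×_; _,_; ∃; proj₁; proj₂)
open import Data.Sum using (_⊎_; inj₁; inj₂; [_,_])
open import Data.Vec using ([]; _∷_; here; there; tabulate)
open import Relation.Nullary using (¬_; Dec; yes; no; does)
open import Relation.Nullary.Decidable using (_×-dec_; dec-true)
open import Relation.Binary.PropositionalEquality
  using (_≡_; _≢_; refl; sym; trans; cong; cong₂; subst; module ≡-Reasoning)

module Subsets where

  open import Data.Nat using (_+_; _≤_; _<_; z≤n; s≤s)
  open import Data.Nat.Properties using (+-suc; m≤m+n; ≤-trans; <-irrefl; +-identityʳ)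
  open import Data.Vec.Properties using (lookup∘tabulate; []=⇒lookup; lookup⇒[]=)
  open import Data.List.Properties using (length-map)
  open import Data.List.Membership.Propositional.Properties using (∈-map⁻)
  open import Data.List.Relation.Unary.Any using (here; there)
  open import Data.List.Relation.Unary.Unique.Propositional using (Unique)
  open import Data.List.Relation.Unary.AllPairs using ([]; _∷_)
  open import Data.List.Relation.Unary.Unique.Propositional.Properties using (map⁺)
  import Data.List.Relation.Unary.All as All

  ∣p∣≡∣p∩q∣+∣p─q∣ : ∀ {n} (p q : Subset n) → ∣ p ∣ ≡ ∣ p ∩ q ∣ + ∣ p ─ q ∣
  ∣p∣≡∣p∩q∣+∣p─q∣ []          []          = refl
  ∣p∣≡∣p∩q∣+∣p─q∣ (true ∷ p)  (true ∷ q)  = cong suc (∣p∣≡∣p∩q∣+∣p─q∣ p q)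
  ∣p∣≡∣p∩q∣+∣p─q∣ (true ∷ p)  (false ∷ q) = trans (cong suc (∣p∣≡∣p∩q∣+∣p─q∣ p q)) (sym (+-suc _ _))
  ∣p∣≡∣p∩q∣+∣p─q∣ (false ∷ p) (true ∷ q)  = ∣p∣≡∣p∩q∣+∣p─q∣ p q
  ∣p∣≡∣p∩q∣+∣p─q∣ (false ∷ p) (false ∷ q) = ∣p∣≡∣p∩q∣+∣p─q∣ p q

  ∣p∪q∣+∣p∩q∣≡∣p∣+∣q∣ : ∀ {n} (p q : Subset n) → ∣ p ∪ q ∣ + ∣ p ∩ q ∣ ≡ ∣ p ∣ + ∣ q ∣
  ∣p∪q∣+∣p∩q∣≡∣p∣+∣q∣ []          []          = refl
  ∣p∪q∣+∣p∩q∣≡∣p∣+∣q∣ (true ∷ p)  (true ∷ q)  =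
    trans (cong suc (trans (+-suc _ _) (cong suc (∣p∪q∣+∣p∩q∣≡∣p∣+∣q∣ p q)))) (cong suc (sym (+-suc _ _)))
  ∣p∪q∣+∣p∩q∣≡∣p∣+∣q∣ (true ∷ p)  (false ∷ q) = cong suc (∣p∪q∣+∣p∩q∣≡∣p∣+∣q∣ p q)
  ∣p∪q∣+∣p∩q∣≡∣p∣+∣q∣ (false ∷ p) (true ∷ q)  = trans (cong suc (∣p∪q∣+∣p∩q∣≡∣p∣+∣q∣ p q)) (sym (+-suc _ _))
  ∣p∪q∣+∣p∩q∣≡∣p∣+∣q∣ (false ∷ p) (false ∷ q) = ∣p∪q∣+∣p∩q∣≡∣p∣+∣q∣ p q

  ∣p∪q∣≤∣p∣+∣q∣ : ∀ {n} (p q : Subset n) → ∣ p ∪ q ∣ ≤ ∣ p ∣ + ∣ q ∣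
  ∣p∪q∣≤∣p∣+∣q∣ p q = subst (∣ p ∪ q ∣ ≤_) (∣p∪q∣+∣p∩q∣≡∣p∣+∣q∣ p q) (m≤m+n _ _)

  Empty⇒∣p∣≡0 : ∀ {n} {p : Subset n} → Empty p → ∣ p ∣ ≡ 0
  Empty⇒∣p∣≡0 {n} empty = trans (cong ∣_∣ (Empty-unique empty)) (∣⊥∣≡0 n)

  disjoint⇒∣p∪q∣≡∣p∣+∣q∣ : ∀ {n} {p q : Subset n} → (∀ {x} → x ∈ p → x ∉ q) → ∣ p ∪ q ∣ ≡ ∣ p ∣ + ∣ q ∣
  disjoint⇒∣p∪q∣≡∣p∣+∣q∣ {p = p} {q} disjoint = begin
    ∣ p ∪ q ∣               ≡⟨ sym (+-identityʳ _) ⟩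
    ∣ p ∪ q ∣ + 0           ≡⟨ cong (∣ p ∪ q ∣ +_) (sym (Empty⇒∣p∣≡0 p∩q-empty)) ⟩
    ∣ p ∪ q ∣ + ∣ p ∩ q ∣   ≡⟨ ∣p∪q∣+∣p∩q∣≡∣p∣+∣q∣ p q ⟩
    ∣ p ∣ + ∣ q ∣           ∎
    where
    open ≡-Reasoning
    p∩q-empty : Empty (p ∩ q)
    p∩q-empty (_ , x∈p∩q) = let (x∈p , x∈q) = x∈p∩q⁻ p q x∈p∩q in disjoint x∈p x∈q

  x∈p⇒0<∣p∣ : ∀ {n} {x : Fin n} {p : Subset n} → x ∈ p → 0 < ∣ p ∣
  x∈p⇒0<∣p∣ here                    = s≤s z≤n
  x∈p⇒0<∣p∣ {p = s ∷ p} (there x∈p) = ≤-trans (x∈p⇒0<∣p∣ x∈p) (∣p∣≤∣x∷p∣ s p)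

  0<∣p∣⇒Nonempty : ∀ {n} {p : Subset n} → 0 < ∣ p ∣ → Nonempty p
  0<∣p∣⇒Nonempty {p = p} 0<∣p∣ with nonempty? p
  ... | yes nonempty = nonempty
  ... | no empty     = ⊥-elim (<-irrefl (sym (Empty⇒∣p∣≡0 empty)) 0<∣p∣)

  x∈p─q⇒x∉q : ∀ {n} {x : Fin n} (p q : Subset n) → x ∈ p ─ q → x ∉ q
  x∈p─q⇒x∉q (_ ∷ p) (false ∷ q) here        ()
  x∈p─q⇒x∉q (_ ∷ p) (true ∷ q)  ()          here
  x∈p─q⇒x∉q (_ ∷ p) (_ ∷ q)     (there x∈) (there x∈q) = x∈p─q⇒x∉q p q x∈ x∈q

  ∪-⊆ : ∀ {n} {p q r : Subset n} → p ⊆ r → q ⊆ r → p ∪ q ⊆ r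
  ∪-⊆ {p = p} {q} p⊆r q⊆r x∈p∪q = [ p⊆r , q⊆r ] (x∈p∪q⁻ p q x∈p∪q)

  ∈-tabulate⁺ : ∀ {n} {f : Fin n → Bool} {x} → f x ≡ true → x ∈ tabulate f
  ∈-tabulate⁺ {f = f} {x} fx≡true = lookup⇒[]= x (tabulate f) (trans (lookup∘tabulate f x) fx≡true)

  ∈-tabulate⁻ : ∀ {n} {f : Fin n → Bool} {x} → x ∈ tabulate f → f x ≡ true
  ∈-tabulate⁻ {f = f} {x} x∈ = trans (sym (lookup∘tabulate f x)) ([]=⇒lookup x∈)

  elements : ∀ {n} → Subset n → List (Fin n)
  elements []          = []
  elements (true ∷ p)  = zero ∷ map suc (elements p)
  elements (false ∷ p) = map suc (elements p)

  length-elements : ∀ {n} (p : Subset n) → length (elements p) ≡ ∣ p ∣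
  length-elements []          = refl
  length-elements (true ∷ p)  = cong suc (trans (length-map suc (elements p)) (length-elements p))
  length-elements (false ∷ p) = trans (length-map suc (elements p)) (length-elements p)

  ∈-elements⁻ : ∀ {n} (p : Subset n) {x} → x ∈ₗ elements p → x ∈ p
  ∈-elements⁻ (true ∷ p)  (here refl) = here
  ∈-elements⁻ (true ∷ p)  (there x∈)  with ∈-map⁻ suc x∈
  ... | y , y∈ , refl = there (∈-elements⁻ p y∈)
  ∈-elements⁻ (false ∷ p) x∈           with ∈-map⁻ suc x∈
  ... | y , y∈ , refl = there (∈-elements⁻ p y∈)

  elements-unique : ∀ {n} (p : Subset n) → Unique (elements p)
  elements-unique []          = []
  elements-unique (true ∷ p)  = All.tabulate zero∉ ∷ map⁺ suc-injective (elements-unique p)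
    where
    zero∉ : ∀ {x} → x ∈ₗ map suc (elements p) → zero ≢ x
    zero∉ x∈ with ∈-map⁻ suc x∈
    ... | _ , _ , refl = λ ()
  elements-unique (false ∷ p) = map⁺ suc-injective (elements-unique p)

module Hall {n : ℕ} (R : Fin n → Fin n → Set) (R? : ∀ x y → Dec (R x y)) where

  open import Data.Fin.Subset using (_-_)
  open import Data.Fin.Subset.Properties using (x∈p∧x≢y⇒x∈p-y; x∈p⇒∣p-x∣<∣p∣)
  open import Data.Nat using (zero; _+_; _≤_; _<_; z≤n; _<?_; _≤?_)
  open import Data.Nat.Properties
    using (≤-refl; ≤-trans; ≤-<-trans; ≤-pred; +-comm; +-monoʳ-≤; +-cancelʳ-≤; ≤⇒≯; ≰⇒>; ≮⇒≥; module ≤-Reasoning)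
  open Subsets

  Γ : Subset n → Subset n
  Γ S = tabulate λ y → does (any? λ x → x ∈? S ×-dec R? x y)

  ∈Γ⁺ : ∀ {S x y} → x ∈ S → R x y → y ∈ Γ S
  ∈Γ⁺ {S} {x} {y} x∈S r = ∈-tabulate⁺ (dec-true (any? λ x → x ∈? S ×-dec R? x y) (x , x∈S , r))

  ∈Γ⁻ : ∀ {S y} → y ∈ Γ S → ∃ λ x → x ∈ S × R x y
  ∈Γ⁻ {S} {y} y∈ΓS with any? (λ x → x ∈? S ×-dec R? x y) | ∈-tabulate⁻ y∈ΓS
  ... | yes witness | _ = witness

  Γ-∪ : ∀ S T → Γ (S ∪ T) ⊆ Γ S ∪ Γ T
  Γ-∪ S T y∈ with ∈Γ⁻ y∈
  ... | x , x∈S∪T , r = [ (λ x∈S → x∈p∪q⁺ (inj₁ (∈Γ⁺ x∈S r))) , (λ x∈T → x∈p∪q⁺ (inj₂ (∈Γ⁺ x∈T r))) ]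
                          (x∈p∪q⁻ S T x∈S∪T)

  HallCondition : Subset n → Subset n → Set
  HallCondition B C = ∀ S → S ⊆ B → ∣ S ∣ ≤ ∣ C ∩ Γ S ∣

  record Marriage (B C : Subset n) : Set where
    field
      partner           : Fin n → Fin n
      partner-∈         : ∀ {x} → x ∈ B → partner x ∈ C
      partner-related   : ∀ {x} → x ∈ B → R x (partner x)
      partner-injective : ∀ {x y} → x ∈ B → y ∈ B → partner x ≡ partner y → x ≡ y

  open Marriage public

  marriage-∅ : ∀ {B C} → Empty B → Marriage B C
  marriage-∅ {B} empty = record
    { partner           = λ x → x
    ; partner-∈         = impossible
    ; partner-related   = impossible
    ; partner-injective = λ x∈B _ _ → impossible x∈B
    }
    where
    impossible : ∀ {A : Set} {x} → x ∈ B → A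
    impossible x∈B = ⊥-elim (empty (_ , x∈B))

  marriage-⁅⁆ : ∀ {b w} → R b w → Marriage ⁅ b ⁆ ⁅ w ⁆
  marriage-⁅⁆ {b} {w} r = record
    { partner           = λ _ → w
    ; partner-∈         = λ _ → x∈⁅x⁆ w
    ; partner-related   = λ x∈⁅b⁆ → subst (λ x → R x w) (sym (x∈⁅y⁆⇒x≡y b x∈⁅b⁆)) r
    ; partner-injective = λ x∈⁅b⁆ y∈⁅b⁆ _ → trans (x∈⁅y⁆⇒x≡y b x∈⁅b⁆) (sym (x∈⁅y⁆⇒x≡y b y∈⁅b⁆))
    }

  marriage-⊆ : ∀ {B C D} → C ⊆ D → Marriage B C → Marriage B D
  marriage-⊆ C⊆D μ = record
    { partner           = partner μ
    ; partner-∈         = λ x∈B → C⊆D (partner-∈ μ x∈B)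
    ; partner-related   = partner-related μ
    ; partner-injective = partner-injective μ
    }

  marriage-Γ : ∀ {B C} → Marriage B C → Marriage B (C ∩ Γ B)
  marriage-Γ μ = record
    { partner           = partner μ
    ; partner-∈         = λ x∈B → x∈p∩q⁺ (partner-∈ μ x∈B , ∈Γ⁺ x∈B (partner-related μ x∈B))
    ; partner-related   = partner-related μ
    ; partner-injective = partner-injective μ
    }

  marriage-glue : ∀ {B C D} S → Marriage S C → Marriage (B ─ S) D →
                  (∀ {y} → y ∈ C → y ∉ D) → Marriage B (C ∪ D)
  marriage-glue {B} {C} {D} S μ ν disjoint = record
    { partner = f ; partner-∈ = f-∈ ; partner-related = f-related ; partner-injective = f-injective }
    where
    f : Fin n → Fin n
    f x with x ∈? S
    ... | yes _ = partner μ x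
    ... | no  _ = partner ν x

    f-∈ : ∀ {x} → x ∈ B → f x ∈ C ∪ D
    f-∈ {x} x∈B with x ∈? S
    ... | yes x∈S = x∈p∪q⁺ (inj₁ (partner-∈ μ x∈S))
    ... | no  x∉S = x∈p∪q⁺ (inj₂ (partner-∈ ν (x∈p∧x∉q⇒x∈p─q x∈B x∉S)))

    f-related : ∀ {x} → x ∈ B → R x (f x)
    f-related {x} x∈B with x ∈? S
    ... | yes x∈S = partner-related μ x∈S
    ... | no  x∉S = partner-related ν (x∈p∧x∉q⇒x∈p─q x∈B x∉S)

    f-injective : ∀ {x y} → x ∈ B → y ∈ B → f x ≡ f y → x ≡ y
    f-injective {x} {y} x∈B y∈B fx≡fy with x ∈? S | y ∈? S
    ... | yes x∈S | yes y∈S = partner-injective μ x∈S y∈S fx≡fy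
    ... | no  x∉S | no  y∉S =
      partner-injective ν (x∈p∧x∉q⇒x∈p─q x∈B x∉S) (x∈p∧x∉q⇒x∈p─q y∈B y∉S) fx≡fy
    ... | yes x∈S | no  y∉S =
      ⊥-elim (disjoint (partner-∈ μ x∈S) (subst (_∈ D) (sym fx≡fy) (partner-∈ ν (x∈p∧x∉q⇒x∈p─q y∈B y∉S))))
    ... | no  x∉S | yes y∈S =
      ⊥-elim (disjoint (partner-∈ μ y∈S) (subst (_∈ D) fx≡fy (partner-∈ ν (x∈p∧x∉q⇒x∈p─q x∈B x∉S))))

  Critical : Subset n → Subset n → Subset n → Set
  Critical B C S = S ⊆ B × 0 < ∣ S ∣ × ∣ S ∣ < ∣ B ∣ × ∣ C ∩ Γ S ∣ ≤ ∣ S ∣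

  critical? : ∀ B C S → Dec (Critical B C S)
  critical? B C S = S ⊆? B ×-dec 0 <? ∣ S ∣ ×-dec ∣ S ∣ <? ∣ B ∣ ×-dec ∣ C ∩ Γ S ∣ ≤? ∣ S ∣

  hallCondition-⊆ : ∀ {B C S} → S ⊆ B → HallCondition B C → HallCondition S C
  hallCondition-⊆ S⊆B hall T T⊆S = hall T (λ x∈T → S⊆B (T⊆S x∈T))

  hallCondition-critical : ∀ {B C} S → S ⊆ B → ∣ C ∩ Γ S ∣ ≤ ∣ S ∣ →
                             HallCondition B C → HallCondition (B ─ S) (C ─ Γ S)
  hallCondition-critical {B} {C} S S⊆B tight hall T T⊆B─S =
    +-cancelʳ-≤ (∣ S ∣) (∣ T ∣) _ (begin
      ∣ T ∣ + ∣ S ∣                               ≡⟨ sym (disjoint⇒∣p∪q∣≡∣p∣+∣q∣ T∩S-disjoint) ⟩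
      ∣ T ∪ S ∣                                   ≤⟨ hall (T ∪ S) (∪-⊆ (λ x∈T → p─q⊆p B S (T⊆B─S x∈T)) S⊆B) ⟩
      ∣ C ∩ Γ (T ∪ S) ∣                           ≤⟨ p⊆q⇒∣p∣≤∣q∣ split ⟩
      ∣ (C ─ Γ S) ∩ Γ T ∪ C ∩ Γ S ∣               ≤⟨ ∣p∪q∣≤∣p∣+∣q∣ ((C ─ Γ S) ∩ Γ T) (C ∩ Γ S) ⟩
      ∣ (C ─ Γ S) ∩ Γ T ∣ + ∣ C ∩ Γ S ∣           ≤⟨ +-monoʳ-≤ (∣ (C ─ Γ S) ∩ Γ T ∣) tight ⟩
      ∣ (C ─ Γ S) ∩ Γ T ∣ + ∣ S ∣                 ∎)
    where
    open ≤-Reasoning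
    T∩S-disjoint : ∀ {x} → x ∈ T → x ∉ S
    T∩S-disjoint x∈T = x∈p─q⇒x∉q B S (T⊆B─S x∈T)
    split : C ∩ Γ (T ∪ S) ⊆ (C ─ Γ S) ∩ Γ T ∪ C ∩ Γ S
    split {y} y∈ with x∈p∩q⁻ C (Γ (T ∪ S)) y∈ | y ∈? Γ S
    ... | y∈C , _     | yes y∈ΓS = x∈p∪q⁺ (inj₂ (x∈p∩q⁺ (y∈C , y∈ΓS)))
    ... | y∈C , y∈ΓTS | no  y∉ΓS with x∈p∪q⁻ (Γ T) (Γ S) (Γ-∪ T S y∈ΓTS)
    ...   | inj₁ y∈ΓT = x∈p∪q⁺ (inj₁ (x∈p∩q⁺ (x∈p∧x∉q⇒x∈p─q y∈C y∉ΓS , y∈ΓT)))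
    ...   | inj₂ y∈ΓS = ⊥-elim (y∉ΓS y∈ΓS)

  hallCondition-noncritical : ∀ {B C} b w → b ∈ B → ¬ ∃ (Critical B C) →
                                HallCondition (B - b) (C - w)
  hallCondition-noncritical {B} {C} b w b∈B noncritical T T⊆B-b with 0 <? ∣ T ∣
  ... | no  ¬0<∣T∣ = ≤-trans (≮⇒≥ ¬0<∣T∣) z≤n
  ... | yes 0<∣T∣  = ≤-pred (begin-strict
      ∣ T ∣                             <⟨ ≰⇒> (λ tight → noncritical (T , T⊆B , 0<∣T∣ , ∣T∣<∣B∣ , tight)) ⟩
      ∣ C ∩ Γ T ∣                       ≤⟨ p⊆q⇒∣p∣≤∣q∣ split ⟩
      ∣ (C - w) ∩ Γ T ∪ ⁅ w ⁆ ∣         ≤⟨ ∣p∪q∣≤∣p∣+∣q∣ ((C - w) ∩ Γ T) ⁅ w ⁆ ⟩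
      ∣ (C - w) ∩ Γ T ∣ + ∣ ⁅ w ⁆ ∣     ≡⟨ cong (∣ (C - w) ∩ Γ T ∣ +_) (∣⁅x⁆∣≡1 w) ⟩
      ∣ (C - w) ∩ Γ T ∣ + 1             ≡⟨ +-comm (∣ (C - w) ∩ Γ T ∣) 1 ⟩
      suc ∣ (C - w) ∩ Γ T ∣             ∎)
    where
    open ≤-Reasoning
    T⊆B : T ⊆ B
    T⊆B x∈T = p─q⊆p B ⁅ b ⁆ (T⊆B-b x∈T)
    ∣T∣<∣B∣ : ∣ T ∣ < ∣ B ∣
    ∣T∣<∣B∣ = ≤-<-trans (p⊆q⇒∣p∣≤∣q∣ T⊆B-b) (x∈p⇒∣p-x∣<∣p∣ b∈B)
    split : C ∩ Γ T ⊆ (C - w) ∩ Γ T ∪ ⁅ w ⁆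
    split {y} y∈ with y ≟ w | x∈p∩q⁻ C (Γ T) y∈
    ... | yes refl | _            = x∈p∪q⁺ (inj₂ (x∈⁅x⁆ w))
    ... | no  y≢w  | y∈C , y∈ΓT  = x∈p∪q⁺ (inj₁ (x∈p∩q⁺ (x∈p∧x≢y⇒x∈p-y y∈C y≢w , y∈ΓT)))

  HallUpTo : ℕ → Set
  HallUpTo k = ∀ {B C} → ∣ B ∣ ≤ k → HallCondition B C → Marriage B C

  marriage-critical : ∀ {k B C S} → HallUpTo k → ∣ B ∣ ≤ suc k → HallCondition B C →
                      Critical B C S → Marriage B C
  marriage-critical {k} {B} {C} {S} hallUpTo ∣B∣≤1+k hall (S⊆B , 0<∣S∣ , ∣S∣<∣B∣ , tight) =
    marriage-⊆ (∪-⊆ (p∩q⊆p C (Γ S)) (p─q⊆p C (Γ S))) (marriage-glue S inner outer disjoint)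
    where
    inner : Marriage S (C ∩ Γ S)
    inner = marriage-Γ (hallUpTo {S} {C} (≤-pred (≤-trans ∣S∣<∣B∣ ∣B∣≤1+k))
                                 (hallCondition-⊆ {C = C} S⊆B hall))
    ∣B─S∣<∣B∣ : ∣ B ─ S ∣ < ∣ B ∣
    ∣B─S∣<∣B∣ with 0<∣p∣⇒Nonempty 0<∣S∣
    ... | x , x∈S = p∩q≢∅⇒∣p─q∣<∣p∣ B S (x , x∈p∩q⁺ (S⊆B x∈S , x∈S))
    outer : Marriage (B ─ S) (C ─ Γ S)
    outer = hallUpTo {B ─ S} {C ─ Γ S} (≤-pred (≤-trans ∣B─S∣<∣B∣ ∣B∣≤1+k))
                     (hallCondition-critical {C = C} S S⊆B tight hall)
    disjoint : ∀ {y} → y ∈ C ∩ Γ S → y ∉ C ─ Γ S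
    disjoint y∈ y∈C─ΓS = x∈p─q⇒x∉q C (Γ S) y∈C─ΓS (proj₂ (x∈p∩q⁻ C (Γ S) y∈))

  marriage-noncritical : ∀ {k B C b} → HallUpTo k → ∣ B ∣ ≤ suc k → HallCondition B C →
                         ¬ ∃ (Critical B C) → b ∈ B → Marriage B C
  marriage-noncritical {k} {B} {C} {b} hallUpTo ∣B∣≤1+k hall noncritical b∈B =
    marriage-⊆ (∪-⊆ (λ y∈⁅w⁆ → subst (_∈ C) (sym (x∈⁅y⁆⇒x≡y w y∈⁅w⁆)) w∈C) (p─q⊆p C ⁅ w ⁆))
               (marriage-glue ⁅ b ⁆ (marriage-⁅⁆ bRw) rest disjoint)
    where
    neighbour : ∃ λ w → w ∈ C ∩ Γ ⁅ b ⁆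
    neighbour = 0<∣p∣⇒Nonempty (subst (_≤ ∣ C ∩ Γ ⁅ b ⁆ ∣) (∣⁅x⁆∣≡1 b)
                  (hall ⁅ b ⁆ (λ x∈⁅b⁆ → subst (_∈ B) (sym (x∈⁅y⁆⇒x≡y b x∈⁅b⁆)) b∈B)))
    w = proj₁ neighbour
    w∈C : w ∈ C
    w∈C = proj₁ (x∈p∩q⁻ C (Γ ⁅ b ⁆) (proj₂ neighbour))
    bRw : R b w
    bRw with ∈Γ⁻ (proj₂ (x∈p∩q⁻ C (Γ ⁅ b ⁆) (proj₂ neighbour)))
    ... | x , x∈⁅b⁆ , xRw = subst (λ x → R x w) (x∈⁅y⁆⇒x≡y b x∈⁅b⁆) xRw
    rest : Marriage (B - b) (C - w)
    rest = hallUpTo {B - b} {C - w} (≤-pred (≤-trans (x∈p⇒∣p-x∣<∣p∣ b∈B) ∣B∣≤1+k))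
                    (hallCondition-noncritical {C = C} b w b∈B noncritical)
    disjoint : ∀ {y} → y ∈ ⁅ w ⁆ → y ∉ C - w
    disjoint y∈⁅w⁆ y∈C-w = x∈p─q⇒x∉q C ⁅ w ⁆ y∈C-w y∈⁅w⁆

  -- Halmos–Vaughan: split B along a critical set if there is one; otherwise every
  -- proper nonempty T ⊆ B has a neighbour to spare, so any edge b w may be used.
  hall-upTo : ∀ k → HallUpTo k
  hall-upTo zero    ∣B∣≤0 _ = marriage-∅ (λ (_ , x∈B) → ≤⇒≯ ∣B∣≤0 (x∈p⇒0<∣p∣ x∈B))
  hall-upTo (suc k) {B} {C} ∣B∣≤1+k hall with anySubset? (critical? B C)
  ... | yes (_ , critical) = marriage-critical (hall-upTo k) ∣B∣≤1+k hall critical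
  ... | no  noncritical with nonempty? B
  ...   | yes (_ , b∈B) = marriage-noncritical (hall-upTo k) ∣B∣≤1+k hall noncritical b∈B
  ...   | no  empty     = marriage-∅ empty

  hall-marriage : ∀ {B C} → HallCondition B C → Marriage B C
  hall-marriage {B} = hall-upTo ∣ B ∣ ≤-refl

module Matchings {n : ℕ} (G : Graph n) where

  open import Data.Bool using (_∨_; if_then_else_)
  open import Data.Nat using (_+_; _≤_)
  open import Data.Nat.Properties using (≤-reflexive; ≤-trans; +-comm; +-mono-≤; +-monoʳ-≤; +-cancelʳ-≤; module ≤-Reasoning)
  open import Data.Nat.Tactic.RingSolver using (solve-∀)
  open import Data.List.Properties using (length-map; length-++)
  open import Data.List.Relation.Unary.Any using (here; there)
  open import Data.List.Relation.Unary.AllPairs using ([]; _∷_)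
  open import Data.List.Relation.Unary.Unique.Propositional using (Unique)
  open import Data.List.Relation.Binary.Disjoint.Propositional using (Disjoint)
  import Data.List.Relation.Unary.All as All
  import Data.List.Relation.Unary.All.Properties as All
  import Data.List.Relation.Unary.Unique.Propositional.Properties as Unique
  open Subsets
  open Hall (Adj G) (adj? G)

  ∈N[]⁻ : ∀ {S w} → w ∈ N[_] G S → w ∈ S ⊎ ∃ λ v → v ∈ S × Adj G v w
  ∈N[]⁻ {S} {w} w∈ with w ∈? S | any? (λ v → v ∈? S ×-dec adj? G v w) | ∈-tabulate⁻ w∈
  ... | yes w∈S | _          | _ = inj₁ w∈S
  ... | no  _   | yes v∈S~w  | _ = inj₂ v∈S~w

  ∈N[]⁺ : ∀ {S w} → w ∈ S ⊎ (∃ λ v → v ∈ S × Adj G v w) → w ∈ N[_] G S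
  ∈N[]⁺ {S} {w} w∈ = ∈-tabulate⁺ (decided w∈)
    where
    decided : w ∈ S ⊎ (∃ λ v → v ∈ S × Adj G v w) →
              (if does (w ∈? S) ∨ does (any? λ v → v ∈? S ×-dec adj? G v w) then true else false) ≡ true
    decided w∈ with w ∈? S | any? (λ v → v ∈? S ×-dec adj? G v w)
    ... | yes _    | _         = refl
    ... | no  _    | yes _     = refl
    ... | no  w∉S  | no  ¬v∈S~w = ⊥-elim ([ w∉S , ¬v∈S~w ] w∈)

  N[]-mono : ∀ {S T} → S ⊆ T → N[_] G S ⊆ N[_] G T
  N[]-mono S⊆T w∈ with ∈N[]⁻ w∈
  ... | inj₁ w∈S             = ∈N[]⁺ (inj₁ (S⊆T w∈S))
  ... | inj₂ (v , v∈S , v~w) = ∈N[]⁺ (inj₂ (v , S⊆T v∈S , v~w))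

  Independent-⊆ : ∀ {S T} → S ⊆ T → Independent G T → Independent G S
  Independent-⊆ S⊆T independent u v u∈S v∈S = independent u v (S⊆T u∈S) (S⊆T v∈S)

  hallCondition-maximum : ∀ {A I} → Independent G A → MaximumIndependent G I → HallCondition (A ─ I) I
  hallCondition-maximum {A} {I} indA (indI , maxI) S S⊆A─I =
    +-cancelʳ-≤ (∣ I ─ Γ S ∣) (∣ S ∣) _ (begin
      ∣ S ∣ + ∣ I ─ Γ S ∣         ≡⟨ sym (disjoint⇒∣p∪q∣≡∣p∣+∣q∣ disjoint) ⟩
      ∣ S ∪ (I ─ Γ S) ∣           ≤⟨ maxI (S ∪ (I ─ Γ S)) independent ⟩
      ∣ I ∣                       ≡⟨ ∣p∣≡∣p∩q∣+∣p─q∣ I (Γ S) ⟩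
      ∣ I ∩ Γ S ∣ + ∣ I ─ Γ S ∣   ∎)
    where
    open ≤-Reasoning
    S⊆A : S ⊆ A
    S⊆A x∈S = p─q⊆p A I (S⊆A─I x∈S)
    disjoint : ∀ {x} → x ∈ S → x ∉ I ─ Γ S
    disjoint x∈S x∈I─ΓS = x∈p─q⇒x∉q A I (S⊆A─I x∈S) (p─q⊆p I (Γ S) x∈I─ΓS)
    independent : Independent G (S ∪ (I ─ Γ S))
    independent u v u∈ v∈ u~v with x∈p∪q⁻ S (I ─ Γ S) u∈ | x∈p∪q⁻ S (I ─ Γ S) v∈
    ... | inj₁ u∈S | inj₁ v∈S = indA u v (S⊆A u∈S) (S⊆A v∈S) u~v
    ... | inj₁ u∈S | inj₂ v∈I─ΓS = x∈p─q⇒x∉q I (Γ S) v∈I─ΓS (∈Γ⁺ u∈S u~v)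
    ... | inj₂ u∈I─ΓS | inj₁ v∈S = x∈p─q⇒x∉q I (Γ S) u∈I─ΓS (∈Γ⁺ v∈S (Graph.sym G u~v))
    ... | inj₂ u∈I─ΓS | inj₂ v∈I─ΓS = indI u v (p─q⊆p I (Γ S) u∈I─ΓS) (p─q⊆p I (Γ S) v∈I─ΓS) u~v

  endpoints-++ : ∀ M E → endpoints G (M ++ E) ≡ endpoints G M ++ endpoints G E
  endpoints-++ []            E = refl
  endpoints-++ ((u , v) ∷ M) E = cong (λ es → u ∷ v ∷ es) (endpoints-++ M E)

  endpoints-⊆ : ∀ {S M x} → IsMatchingIn G S M → x ∈ₗ endpoints G M → x ∈ S
  endpoints-⊆ {M = _ ∷ _} ((_ , u∈S , _) ∷ _ , _) (here refl)         = u∈S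
  endpoints-⊆ {M = _ ∷ _} ((_ , _ , v∈S) ∷ _ , _) (there (here refl)) = v∈S
  endpoints-⊆ {M = _ ∷ _} (_ ∷ edges , _ ∷ _ ∷ unique) (there (there x∈)) = endpoints-⊆ (edges , unique) x∈

  IsMatchingIn-mono : ∀ {S T M} → S ⊆ T → IsMatchingIn G S M → IsMatchingIn G T M
  IsMatchingIn-mono {M = []}    S⊆T ([] , unique) = [] , unique
  IsMatchingIn-mono {M = _ ∷ _} S⊆T ((u~v , u∈S , v∈S) ∷ edges , unique@(_ ∷ _ ∷ unique′)) =
    (u~v , S⊆T u∈S , S⊆T v∈S) ∷ proj₁ (IsMatchingIn-mono S⊆T (edges , unique′)) , unique

  IsMatchingIn-++ : ∀ {S M E} → IsMatchingIn G S M → IsMatchingIn G S E →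
                    Disjoint (endpoints G M) (endpoints G E) → IsMatchingIn G S (M ++ E)
  IsMatchingIn-++ {M = M} {E} (edgesM , uniqueM) (edgesE , uniqueE) disjoint =
    All.++⁺ edgesM edgesE , subst Unique (sym (endpoints-++ M E)) (Unique.++⁺ uniqueM uniqueE disjoint)

  graphEdges : (Fin n → Fin n) → List (Fin n) → List (Fin n × Fin n)
  graphEdges f = map λ b → b , f b

  ∈-endpoints-graphEdges⁻ : ∀ f bs {x} → x ∈ₗ endpoints G (graphEdges f bs) →
                            ∃ λ b → b ∈ₗ bs × (x ≡ b ⊎ x ≡ f b)
  ∈-endpoints-graphEdges⁻ f (b ∷ bs) (here x≡b)         = b , here refl , inj₁ x≡b
  ∈-endpoints-graphEdges⁻ f (b ∷ bs) (there (here x≡fb)) = b , here refl , inj₂ x≡fb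
  ∈-endpoints-graphEdges⁻ f (b ∷ bs) (there (there x∈)) with ∈-endpoints-graphEdges⁻ f bs x∈
  ... | c , c∈bs , x≡ = c , there c∈bs , x≡

  graphEdges-isMatching : ∀ {S f bs} → Unique bs →
    (∀ {b} → b ∈ₗ bs → Adj G b (f b) × b ∈ S × f b ∈ S) →
    (∀ {b c} → b ∈ₗ bs → c ∈ₗ bs → b ≢ f c) →
    (∀ {b c} → b ∈ₗ bs → c ∈ₗ bs → f b ≡ f c → b ≡ c) →
    IsMatchingIn G S (graphEdges f bs)
  graphEdges-isMatching {bs = []}     _               _     _       _         = [] , []
  graphEdges-isMatching {S} {f} {b ∷ bs} (b∉bs ∷ unique) edge loopless injective =
    edge (here refl) ∷ proj₁ rest ,
    (loopless (here refl) (here refl) ∷ All.tabulate b∉) ∷ All.tabulate fb∉ ∷ proj₂ rest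
    where
    rest : IsMatchingIn G S (graphEdges f bs)
    rest = graphEdges-isMatching unique (λ c∈ → edge (there c∈))
             (λ c∈ d∈ → loopless (there c∈) (there d∈)) (λ c∈ d∈ → injective (there c∈) (there d∈))
    b∉ : ∀ {x} → x ∈ₗ endpoints G (graphEdges f bs) → b ≢ x
    b∉ x∈ with ∈-endpoints-graphEdges⁻ f bs x∈
    ... | c , c∈bs , inj₁ refl = All.lookup b∉bs c∈bs
    ... | c , c∈bs , inj₂ refl = loopless (here refl) (there c∈bs)
    fb∉ : ∀ {x} → x ∈ₗ endpoints G (graphEdges f bs) → f b ≢ x
    fb∉ x∈ fb≡x with ∈-endpoints-graphEdges⁻ f bs x∈
    ... | c , c∈bs , inj₁ refl = loopless (there c∈bs) (here refl) (sym fb≡x)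
    ... | c , c∈bs , inj₂ refl = All.lookup b∉bs c∈bs (injective (here refl) (there c∈bs) fb≡x)

  marriageEdges : ∀ {B C} → Marriage B C → List (Fin n × Fin n)
  marriageEdges {B} μ = graphEdges (partner μ) (elements B)

  length-marriageEdges : ∀ {B C} (μ : Marriage B C) → length (marriageEdges μ) ≡ ∣ B ∣
  length-marriageEdges {B} μ = trans (length-map _ (elements B)) (length-elements B)

  ∈-endpoints-marriageEdges⁻ : ∀ {B C x} (μ : Marriage B C) → x ∈ₗ endpoints G (marriageEdges μ) →
                               ∃ λ b → b ∈ B × (x ≡ b ⊎ x ≡ partner μ b)
  ∈-endpoints-marriageEdges⁻ {B} μ x∈ with ∈-endpoints-graphEdges⁻ (partner μ) (elements B) x∈
  ... | b , b∈ , x≡ = b , ∈-elements⁻ B b∈ , x≡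

  marriageEdges-isMatching : ∀ {B C S} (μ : Marriage B C) → (∀ {x} → x ∈ B → x ∉ C) →
                             (∀ {b} → b ∈ B → b ∈ S × partner μ b ∈ S) → IsMatchingIn G S (marriageEdges μ)
  marriageEdges-isMatching {B} {C} μ disjoint covered = graphEdges-isMatching (elements-unique B)
    (λ b∈ → partner-related μ (∈-elements⁻ B b∈) , covered (∈-elements⁻ B b∈))
    (λ b∈ c∈ b≡ → disjoint (∈-elements⁻ B b∈) (subst (_∈ C) (sym b≡) (partner-∈ μ (∈-elements⁻ B c∈))))
    (λ b∈ c∈ → partner-injective μ (∈-elements⁻ B b∈) (∈-elements⁻ B c∈))

  -- The matching-level form of  |A| − μ(G[N[A]]) ≤ |S| − μ(G[N[S]]).
  Extends : Subset n → Subset n → Set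
  Extends S A = ∀ M → IsMatchingIn G (N[_] G S) M →
                ∃ λ M′ → IsMatchingIn G (N[_] G A) M′ × length M + ∣ A ∣ ≤ ∣ S ∣ + length M′

  extends-refl : ∀ A → Extends A A
  extends-refl A M M-matching = M , M-matching , ≤-reflexive (+-comm (length M) ∣ A ∣)

  ≤-telescope : ∀ m a s t m′ m″ → m + t ≤ s + m′ → m′ + a ≤ t + m″ → m + a ≤ s + m″
  ≤-telescope m a s t m′ m″ p q = +-cancelʳ-≤ (t + m′) (m + a) (s + m″) (begin
    (m + a) + (t + m′)   ≡⟨ regroup m a t m′ ⟩
    (m + t) + (m′ + a)   ≤⟨ +-mono-≤ p q ⟩
    (s + m′) + (t + m″)  ≡⟨ regroup′ s m′ t m″ ⟩
    (s + m″) + (t + m′)  ∎)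
    where
    open ≤-Reasoning
    regroup : ∀ m a t m′ → (m + a) + (t + m′) ≡ (m + t) + (m′ + a)
    regroup = solve-∀
    regroup′ : ∀ s m′ t m″ → (s + m′) + (t + m″) ≡ (s + m″) + (t + m′)
    regroup′ = solve-∀

  extends-trans : ∀ {S T A} → Extends S T → Extends T A → Extends S A
  extends-trans {S} {T} {A} S→T T→A M M-matching with S→T M M-matching
  ... | M′ , M′-matching , gain₁ with T→A M′ M′-matching
  ...   | M″ , M″-matching , gain₂ =
    M″ , M″-matching , ≤-telescope (length M) (∣ A ∣) (∣ S ∣) (∣ T ∣) (length M′) (length M″) gain₁ gain₂

  matching-avoiding-N[∩] : ∀ {A I} → Independent G A → MaximumIndependent G I →
                           ∃ λ E → IsMatchingIn G (N[_] G A) E × length E ≡ ∣ A ─ I ∣ ×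
                                   (∀ {x} → x ∈ₗ endpoints G E → x ∉ N[_] G (A ∩ I))
  matching-avoiding-N[∩] {A} {I} indA maxI@(indI , _) = marriageEdges μ , matching , length-marriageEdges μ , avoids
    where
    μ : Marriage (A ─ I) I
    μ = hall-marriage (hallCondition-maximum indA maxI)
    A─I⊆A : A ─ I ⊆ A
    A─I⊆A = p─q⊆p A I
    matching : IsMatchingIn G (N[_] G A) (marriageEdges μ)
    matching = marriageEdges-isMatching μ (x∈p─q⇒x∉q A I)
      (λ b∈ → ∈N[]⁺ (inj₁ (A─I⊆A b∈)) , ∈N[]⁺ (inj₂ (_ , A─I⊆A b∈ , partner-related μ b∈)))
    avoids : ∀ {x} → x ∈ₗ endpoints G (marriageEdges μ) → x ∉ N[_] G (A ∩ I)
    avoids x∈E x∈N[A∩I] with ∈-endpoints-marriageEdges⁻ μ x∈E | ∈N[]⁻ x∈N[A∩I]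
    ... | b , b∈ , inj₁ refl | inj₁ b∈A∩I =
      x∈p─q⇒x∉q A I b∈ (p∩q⊆q A I b∈A∩I)
    ... | b , b∈ , inj₁ refl | inj₂ (v , v∈A∩I , v~b) =
      indA v b (p∩q⊆p A I v∈A∩I) (A─I⊆A b∈) v~b
    ... | b , b∈ , inj₂ refl | inj₁ fb∈A∩I =
      indA b (partner μ b) (A─I⊆A b∈) (p∩q⊆p A I fb∈A∩I) (partner-related μ b∈)
    ... | b , b∈ , inj₂ refl | inj₂ (v , v∈A∩I , v~fb) =
      indI v (partner μ b) (p∩q⊆q A I v∈A∩I) (partner-∈ μ b∈) v~fb

  extends-∩-maximum : ∀ {A I} → Independent G A → MaximumIndependent G I → Extends (A ∩ I) A
  extends-∩-maximum {A} {I} indA maxI M M-matching with matching-avoiding-N[∩] indA maxI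
  ... | E , E-matching , ∣E∣≡∣A─I∣ , avoids =
    M ++ E ,
    IsMatchingIn-++ (IsMatchingIn-mono (N[]-mono (p∩q⊆p A I)) M-matching) E-matching
                    (λ (x∈M , x∈E) → avoids x∈E (endpoints-⊆ M-matching x∈M)) ,
    ≤-reflexive (begin
      length M + ∣ A ∣                    ≡⟨ cong (length M +_) (∣p∣≡∣p∩q∣+∣p─q∣ A I) ⟩
      length M + (∣ A ∩ I ∣ + ∣ A ─ I ∣)    ≡⟨ regroup (length M) (∣ A ∩ I ∣) (∣ A ─ I ∣) ⟩
      ∣ A ∩ I ∣ + (length M + ∣ A ─ I ∣)    ≡⟨ cong (λ e → ∣ A ∩ I ∣ + (length M + e)) (sym ∣E∣≡∣A─I∣) ⟩
      ∣ A ∩ I ∣ + (length M + length E)     ≡⟨ cong (∣ A ∩ I ∣ +_) (sym (length-++ M)) ⟩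
      ∣ A ∩ I ∣ + length (M ++ E)           ∎)
    where
    open ≡-Reasoning
    regroup : ∀ m a b → m + (a + b) ≡ a + (m + b)
    regroup = solve-∀

  extends-⋂ : ∀ {L A} → All (MaximumIndependent G) L → Independent G A → Extends (A ∩ ⋂ L) A
  extends-⋂ {[]} {A} [] _ = subst (λ S → Extends S A) (sym (∩-identityʳ A)) (extends-refl A)
  extends-⋂ {I ∷ L} {A} (maxI ∷ maxL) indA = extends-trans inner (extends-∩-maximum indA maxI)
    where
    inner : Extends (A ∩ (I ∩ ⋂ L)) (A ∩ I)
    inner = subst (λ S → Extends S (A ∩ I)) (∩-assoc A I (⋂ L))
                  (extends-⋂ maxL (Independent-⊆ (p∩q⊆p A I) indA))

  deficiency-bound : ∀ {L A μA μX} → All (MaximumIndependent G) L → Independent G A → ⋂ L ⊆ A →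
                     MatchingNumber G (N[_] G A) μA → MatchingNumber G (N[_] G (⋂ L)) μX →
                     μX + ∣ A ∣ ≤ ∣ ⋂ L ∣ + μA
  deficiency-bound {L} {A} maxL indA X⊆A (_ , maximumA) ((MX , MX-matching , refl) , _) =
    let (M , M-matching , gain) = extends-X MX MX-matching in
    ≤-trans gain (+-monoʳ-≤ (∣ ⋂ L ∣) (maximumA M M-matching))
    where
    extends-X : Extends (⋂ L) A
    extends-X = subst (λ S → Extends S A) (⊆-antisym (p∩q⊆q A (⋂ L)) (λ x∈X → x∈p∩q⁺ (X⊆A x∈X , x∈X)))
                      (extends-⋂ maxL indA)

import Data.Nat as ℕ
import Data.Nat.Properties as ℕ
open import Data.Integer using (_-_; _≤_; +_; _⊖_)
import Data.Integer.Properties as ℤ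
import Data.List.Relation.Unary.All.Properties as All
open Matchings using (deficiency-bound)

p+m≤o+n⇒m-n≤o-p : ∀ m n o p → p ℕ.+ m ℕ.≤ o ℕ.+ n → + m - + n ≤ + o - + p
p+m≤o+n⇒m-n≤o-p m n o p p+m≤o+n = begin
  + m - + n               ≡⟨ ℤ.m-n≡m⊖n m n ⟩
  m ⊖ n                   ≡⟨ ℤ.+-cancelˡ-⊖ p m n ⟨
  (p ℕ.+ m) ⊖ (p ℕ.+ n)   ≤⟨ ℤ.⊖-monoˡ-≤ (p ℕ.+ n) p+m≤o+n ⟩
  (o ℕ.+ n) ⊖ (p ℕ.+ n)   ≡⟨ cong₂ _⊖_ (ℕ.+-comm o n) (ℕ.+-comm p n) ⟩
  (n ℕ.+ o) ⊖ (n ℕ.+ p)   ≡⟨ ℤ.+-cancelˡ-⊖ n o p ⟩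
  o ⊖ p                   ≡⟨ ℤ.m-n≡m⊖n o p ⟨
  + o - + p               ∎
  where open ℤ.≤-Reasoning

lemma4 : ∀ {n k} (G : Graph n) (Xs : Fin (suc k) → Subset n)
    → (∀ i → MaximumIndependent G (Xs i))
    → (A : Subset n) → Independent G A → ⋂Fam Xs ⊆ A
    → (μA μX : ℕ) → MatchingNumber G (N[_] G A) μA
    → MatchingNumber G (N[_] G (⋂Fam Xs)) μX
    → (+ ∣ A ∣) - (+ μA) ≤ (+ ∣ ⋂Fam Xs ∣) - (+ μX)
lemma4 G Xs maximum A independent X⊆A μA μX μA-matchingNumber μX-matchingNumber =
  p+m≤o+n⇒m-n≤o-p (∣ A ∣) μA (∣ ⋂Fam Xs ∣) μX
    (deficiency-bound G (All.tabulate⁺ maximum) independent X⊆A μA-matchingNumber μX-matchingNumber)
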